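{- Let $(c_j,I_j)_{j}$ be the signature of a non-decreasing function $g:\mathbb{N}\to\mathbb{N}$, and let $k$ be such that $c_k,I_k$ are defined. For each $t<k$, \[ S_k(t)\ \ge\ \sum_{i\le t}|I_{k-i}|\cdot 2^{ -c_{k-i}}\ -\ 1. \]
   Context: The signature of a non-decreasing $g:\mathbb{N}\to\mathbb{N}$ is the (finite or infinite) sequence $(c_j,I_j)$, $j\ge 0$, where $(I_j)$ is a partition of $\mathbb{N}$ into intervals (listed in increasing order), $g(x)=c_j$ for all $x\in I_j$, and $c_j>c_{j'}$ whenever $j>j'$. For a real $x\ge0$ and an integer $c$, the truncation is $T(x,c)=2^{ -c}\lfloor 2^c x\rfloor$ (equivalently, the sum of the first terms up to $c_t=c$ in the greedy representation $x=\sum_i n_i 2^{ -c_i}$ with $n_{i+1}2^{ -c_{i+1}}<2^{ -c_i}$). The truncated sums with respect to $k$ are defined for $i<k$ by $S_k(0)=T(|I_k|\cdot 2^{ -c_k},c_{k-1})$ and $S_k(i)=T(|I_{k-i}|\cdot 2^{ -c_{k-i}}+S_k(i-1),\,c_{k-i-1})$ for $0<i<k$. -}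

module Defs where

open import Data.Nat as ℕ using (ℕ; zero; suc; _∸_; _^_; _≤_; _<_)
open import Data.Nat.Properties using (m^n≢0)
open import Data.Integer as ℤ using (ℤ; +_)
open import Data.Rational using (ℚ; _/_; _+_; _*_; floor)
open import Data.Product using (_×_)
open import Relation.Binary.PropositionalEquality using (_≡_)

pow2inv : ℕ → ℚ
pow2inv c = (+ 1 / (2 ^ c)) {{m^n≢0 2 c}}

pow2 : ℕ → ℚ
pow2 c = + (2 ^ c) / 1

T : ℚ → ℕ → ℚ
T x c = (floor (pow2 c * x) / (2 ^ c)) {{m^n≢0 2 c}}

-- (b , c) describe the first k+1 entries of the signature of g:
--   I_j = [ b j , b (suc j) )  and  g = c j on I_j,  for j ≤ k,
--   with I_0 starting at 0 and each I_j maximal (g jumps above c j at b (suc j)).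
IsSignatureUpTo : (g : ℕ → ℕ) (k : ℕ) (b c : ℕ → ℕ) → Set
IsSignatureUpTo g k b c =
  (b 0 ≡ 0) ×
  (∀ j → j ≤ k → b j < b (suc j)) ×
  (∀ j x → j ≤ k → b j ≤ x → x < b (suc j) → g x ≡ c j) ×
  (∀ j → j ≤ k → c j < g (b (suc j)))

NonDecreasing : (ℕ → ℕ) → Set
NonDecreasing g = ∀ x y → x ≤ y → g x ≤ g y

term : (b c : ℕ → ℕ) → ℕ → ℚ
term b c j = (+ (b (suc j) ∸ b j) / 1) * pow2inv (c j)

S : (b c : ℕ → ℕ) (k : ℕ) → ℕ → ℚ
S b c k zero    = T (term b c k) (c (k ∸ 1))
S b c k (suc i) = T (term b c (k ∸ suc i) + S b c k i) (c (k ∸ suc i ∸ 1))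

partialSum : (b c : ℕ → ℕ) (k : ℕ) → ℕ → ℚ
partialSum b c k zero    = term b c k
partialSum b c k (suc t) = partialSum b c k t + term b c (k ∸ suc t)

-- Truncating to precision 2^-c loses strictly less than 2^-c, and if x already lies on
-- the finer grid 2^-d ℤ (d ≥ c) then, both x and T(x,c) + 2^-c being on that grid, the
-- loss is at most 2^-c - 2^-d. The values c_j increase, so the truncations in S_k
-- become coarser step by step and these losses telescope: by induction on i,
--   Σ_{i' ≤ i} |I_{k-i'}| 2^-c_{k-i'} + 2^-c_k  ≤  S_k(i) + 2^-c_{k-i-1}  ≤  S_k(i) + 1.
module Submission where

open import Algebra.Bundles using (CommutativeMonoid)
import Algebra.Properties.CommutativeSemigroup as CommSemigroupProperties
open import Data.Integer.Base as ℤ using (ℤ; +_; 1ℤ)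
import Data.Integer.DivMod as ℤ
import Data.Integer.Properties as ℤ
open import Data.Integer.Solver using (module +-*-Solver)
open import Data.Nat.Base as ℕ using (ℕ; zero; suc; _∸_; _^_)
import Data.Nat.Properties as ℕ
open import Data.Product.Base using (∃-syntax; _,_; proj₂)
open import Data.Rational.Base
  using (ℚ; mkℚ; _/_; _+_; _*_; _-_; -_; 0ℚ; 1ℚ; floor; toℚᵘ; Positive; _≤_; _<_)
open import Data.Rational.Literals using (fromℤ)
import Data.Rational.Properties as ℚ
import Data.Rational.Unnormalised.Base as ℚᵘ
import Data.Rational.Unnormalised.Properties as ℚᵘ
open import Relation.Binary.PropositionalEquality

open import Defs

open CommSemigroupProperties (CommutativeMonoid.commutativeSemigroup ℚ.*-1-commutativeMonoid)
  using (x∙yz≈y∙xz; x∙yz≈yx∙z)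
open CommSemigroupProperties (CommutativeMonoid.commutativeSemigroup ℚ.+-0-commutativeMonoid)
  using (xy∙z≈xz∙y; xy∙z≈zx∙y)

infix 8 _/1

_/1 : ℤ → ℚ
i /1 = i / 1

toℚᵘ-/ : ∀ i n .{{_ : ℕ.NonZero n}} → toℚᵘ (i / n) ℚᵘ.≃ (i ℚᵘ./ n)
toℚᵘ-/ i (suc m) = ℚ.toℚᵘ-fromℚᵘ (ℚᵘ.mkℚᵘ i m)

toℚᵘ-/1 : ∀ i → toℚᵘ (i /1) ≡ ℚᵘ.mkℚᵘ i 0
toℚᵘ-/1 i = cong toℚᵘ (ℚ.↥p/↧p≡p (fromℤ i))

/-*-/ : ∀ i j m n .{{_ : ℕ.NonZero m}} .{{_ : ℕ.NonZero n}} →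
        (i / m) * (j / n) ≡ ((i ℤ.* j) / (m ℕ.* n)) {{ℕ.m*n≢0 m n}}
/-*-/ i j m@(suc _) n@(suc _) = ℚ.toℚᵘ-injective (ℚᵘ.≃-trans (ℚ.toℚᵘ-homo-* (i / m) (j / n))
  (ℚᵘ.≃-trans (ℚᵘ.*-cong (toℚᵘ-/ i m) (toℚᵘ-/ j n)) (ℚᵘ.≃-sym (toℚᵘ-/ (i ℤ.* j) (m ℕ.* n)))))

i/n≡i/1*1/n : ∀ i n .{{_ : ℕ.NonZero n}} → i / n ≡ i /1 * (+ 1 / n)
i/n≡i/1*1/n i n = sym (trans (/-*-/ i (+ 1) 1 n) (ℚ./-cong (ℤ.*-identityʳ i) (ℕ.*-identityˡ n)))
  where instance _ = ℕ.m*n≢0 1 n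

n/n≡1 : ∀ n .{{_ : ℕ.NonZero n}} → + n / n ≡ 1ℚ
n/n≡1 n@(suc _) = ℚ.toℚᵘ-injective (ℚᵘ.≃-trans (toℚᵘ-/ (+ n) n) (ℚᵘ.*≡* (ℤ.*-comm (+ n) (+ 1))))

1/n≤1 : ∀ n .{{_ : ℕ.NonZero n}} → + 1 / n ≤ 1ℚ
1/n≤1 n@(suc _) = ℚ.toℚᵘ-cancel-≤
  (ℚᵘ.≤-respˡ-≃ (ℚᵘ.≃-sym (toℚᵘ-/ (+ 1) n)) (ℚᵘ.*≤* (ℤ.+≤+ (ℕ.s≤s ℕ.z≤n))))

/1-homo-+ : ∀ a b → (a ℤ.+ b) /1 ≡ a /1 + b /1
/1-homo-+ a b = ℚ.toℚᵘ-injective (begin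
  toℚᵘ ((a ℤ.+ b) /1)            ≡⟨ toℚᵘ-/1 (a ℤ.+ b) ⟩
  ℚᵘ.mkℚᵘ (a ℤ.+ b) 0            ≈⟨ ℚᵘ.*≡* (solve 2 (λ a b → (a :+ b) :* con 1ℤ := (a :* con 1ℤ :+ b :* con 1ℤ) :* con 1ℤ) refl a b) ⟩
  ℚᵘ.mkℚᵘ a 0 ℚᵘ.+ ℚᵘ.mkℚᵘ b 0   ≡⟨ cong₂ ℚᵘ._+_ (toℚᵘ-/1 a) (toℚᵘ-/1 b) ⟨
  toℚᵘ (a /1) ℚᵘ.+ toℚᵘ (b /1)   ≈⟨ ℚ.toℚᵘ-homo-+ (a /1) (b /1) ⟨
  toℚᵘ (a /1 + b /1)             ∎)
  where open ℚᵘ.≃-Reasoning; open +-*-Solver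

/1-homo-* : ∀ a b → (a ℤ.* b) /1 ≡ a /1 * b /1
/1-homo-* a b = sym (/-*-/ a b 1 1)

/1-mono-≤ : ∀ {a b} → a ℤ.≤ b → a /1 ≤ b /1
/1-mono-≤ {a} {b} a≤b = ℚ.toℚᵘ-cancel-≤
  (subst₂ ℚᵘ._≤_ (sym (toℚᵘ-/1 a)) (sym (toℚᵘ-/1 b)) (ℚᵘ.*≤* (ℤ.*-monoʳ-≤-nonNeg (+ 1) a≤b)))

/1-cancel-< : ∀ {a b} → a /1 < b /1 → a ℤ.< b
/1-cancel-< {a} {b} a<b with subst₂ ℚᵘ._<_ (toℚᵘ-/1 a) (toℚᵘ-/1 b) (ℚ.toℚᵘ-mono-< a<b)
... | ℚᵘ.*<* a*1<b*1 = ℤ.*-cancelʳ-<-nonNeg (+ 1) a*1<b*1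

suc-/1-* : ∀ z h → ℤ.suc z /1 * h ≡ z /1 * h + h
suc-/1-* z h = begin
  (1ℤ ℤ.+ z) /1 * h    ≡⟨ cong (_* h) (/1-homo-+ 1ℤ z) ⟩
  (1ℚ + z /1) * h      ≡⟨ ℚ.*-distribʳ-+ h 1ℚ (z /1) ⟩
  1ℚ * h + z /1 * h    ≡⟨ cong (_+ z /1 * h) (ℚ.*-identityˡ h) ⟩
  h + z /1 * h         ≡⟨ ℚ.+-comm h (z /1 * h) ⟩
  z /1 * h + h         ∎
  where open ≡-Reasoning

p<⌊p⌋+1 : ∀ p → p < ℤ.suc (floor p) /1
p<⌊p⌋+1 p@(mkℚ n d _) = ℚ.toℚᵘ-cancel-<
  (subst (toℚᵘ p ℚᵘ.<_) (sym (toℚᵘ-/1 (ℤ.suc (floor p)))) (ℚᵘ.*<* n*1<⌊p⌋+1*d))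
  where
  n*1<⌊p⌋+1*d : n ℤ.* + 1 ℤ.< ℤ.suc (floor p) ℤ.* + suc d
  n*1<⌊p⌋+1*d = subst₂ ℤ._<_ (sym (ℤ.*-identityʳ n))
    (cong (λ q → ℤ.suc q ℤ.* + suc d) (sym (ℤ.div-pos-is-/ℕ n (suc d))))
    (ℤ.n<s[n/ℕd]*d n (suc d))

p≤q+r⇒p-r≤q : ∀ {p q r} → p ≤ q + r → p - r ≤ q
p≤q+r⇒p-r≤q {p} {q} {r} p≤q+r = begin
  p - r           ≤⟨ ℚ.+-monoˡ-≤ (- r) p≤q+r ⟩
  q + r - r       ≡⟨ ℚ.+-assoc q r (- r) ⟩
  q + (r - r)     ≡⟨ cong (_+_ q) (ℚ.+-inverseʳ r) ⟩
  q + 0ℚ          ≡⟨ ℚ.+-identityʳ q ⟩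
  q               ∎
  where open ℚ.≤-Reasoning

infix 4 _∈_ℤ

_∈_ℤ : ℚ → ℚ → Set
x ∈ h ℤ = ∃[ z ] x ≡ z /1 * h

∈ℤ-refl : ∀ h → h ∈ h ℤ
∈ℤ-refl h = 1ℤ , sym (ℚ.*-identityˡ h)

∈ℤ-trans : ∀ {x h h′} → x ∈ h ℤ → h ∈ h′ ℤ → x ∈ h′ ℤ
∈ℤ-trans {x} {h} {h′} (z , x≡zh) (w , h≡wh′) = z ℤ.* w , (begin
  x                      ≡⟨ x≡zh ⟩
  z /1 * h               ≡⟨ cong (z /1 *_) h≡wh′ ⟩
  z /1 * (w /1 * h′)     ≡⟨ ℚ.*-assoc (z /1) (w /1) h′ ⟨
  z /1 * w /1 * h′       ≡⟨ cong (_* h′) (/1-homo-* z w) ⟨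
  (z ℤ.* w) /1 * h′      ∎)
  where open ≡-Reasoning

∈ℤ-+ : ∀ {x y h} → x ∈ h ℤ → y ∈ h ℤ → x + y ∈ h ℤ
∈ℤ-+ {x} {y} {h} (z , x≡zh) (w , y≡wh) = z ℤ.+ w , (begin
  x + y                  ≡⟨ cong₂ _+_ x≡zh y≡wh ⟩
  z /1 * h + w /1 * h    ≡⟨ ℚ.*-distribʳ-+ h (z /1) (w /1) ⟨
  (z /1 + w /1) * h      ≡⟨ cong (_* h) (/1-homo-+ z w) ⟨
  (z ℤ.+ w) /1 * h       ∎)
  where open ≡-Reasoning

∈ℤ-discrete : ∀ {x y} h .{{_ : Positive h}} → x ∈ h ℤ → y ∈ h ℤ → x < y → x + h ≤ y
∈ℤ-discrete {x} {y} h (z , refl) (w , refl) zh<wh = begin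
  z /1 * h + h           ≡⟨ suc-/1-* z h ⟨
  ℤ.suc z /1 * h         ≤⟨ ℚ.*-monoʳ-≤-nonNeg h (/1-mono-≤ (ℤ.i<j⇒suc[i]≤j z<w)) ⟩
  w /1 * h               ∎
  where
  open ℚ.≤-Reasoning
  instance _ = ℚ.pos⇒nonNeg h
  z<w : z ℤ.< w
  z<w = /1-cancel-< (ℚ.*-cancelʳ-<-nonNeg h zh<wh)

pow2inv-pos : ∀ c → Positive (pow2inv c)
pow2inv-pos c = ℚ.normalize-pos 1 (2 ^ c) {{ℕ.m^n≢0 2 c}}

pow2inv≤1 : ∀ c → pow2inv c ≤ 1ℚ
pow2inv≤1 c = 1/n≤1 (2 ^ c) {{ℕ.m^n≢0 2 c}}

pow2-*-pow2inv : ∀ c → pow2 c * pow2inv c ≡ 1ℚ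
pow2-*-pow2inv c = begin
  pow2 c * pow2inv c                  ≡⟨ /-*-/ (+ (2 ^ c)) (+ 1) 1 (2 ^ c) ⟩
  (+ (2 ^ c) ℤ.* + 1) / (1 ℕ.* 2 ^ c) ≡⟨ ℚ./-cong (ℤ.*-identityʳ (+ (2 ^ c))) (ℕ.*-identityˡ (2 ^ c)) ⟩
  + (2 ^ c) / 2 ^ c                   ≡⟨ n/n≡1 (2 ^ c) ⟩
  1ℚ                                  ∎
  where
  open ≡-Reasoning
  instance _ = ℕ.m^n≢0 2 c; _ = ℕ.m*n≢0 1 (2 ^ c)

pow2inv-+ : ∀ c e → pow2inv (c ℕ.+ e) ≡ pow2inv c * pow2inv e
pow2inv-+ c e = sym (trans (/-*-/ (+ 1) (+ 1) (2 ^ c) (2 ^ e))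
                           (ℚ./-cong {p₁ = + 1} refl (sym (ℕ.^-distribˡ-+-* 2 c e))))
  where
  instance
    _ = ℕ.m^n≢0 2 c
    _ = ℕ.m^n≢0 2 e
    _ = ℕ.m^n≢0 2 (c ℕ.+ e)
    _ = ℕ.m*n≢0 (2 ^ c) (2 ^ e)

pow2inv-∈ℤ : ∀ {c d} → c ℕ.≤ d → pow2inv c ∈ pow2inv d ℤ
pow2inv-∈ℤ {c} {d} c≤d = + (2 ^ e) , (begin
  pow2inv c                           ≡⟨ ℚ.*-identityʳ (pow2inv c) ⟨
  pow2inv c * 1ℚ                      ≡⟨ cong (pow2inv c *_) (pow2-*-pow2inv e) ⟨
  pow2inv c * (pow2 e * pow2inv e)    ≡⟨ x∙yz≈y∙xz (pow2inv c) (pow2 e) (pow2inv e) ⟩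
  pow2 e * (pow2inv c * pow2inv e)    ≡⟨ cong (pow2 e *_) (pow2inv-+ c e) ⟨
  pow2 e * pow2inv (c ℕ.+ e)          ≡⟨ cong (λ d → pow2 e * pow2inv d) (ℕ.m+[n∸m]≡n c≤d) ⟩
  pow2 e * pow2inv d                  ∎)
  where
  open ≡-Reasoning
  e = d ∸ c

T-∈ℤ : ∀ x c → T x c ∈ pow2inv c ℤ
T-∈ℤ x c = floor (pow2 c * x) , i/n≡i/1*1/n (floor (pow2 c * x)) (2 ^ c)
  where instance _ = ℕ.m^n≢0 2 c

x<T[x,c]+2^-c : ∀ x c → x < T x c + pow2inv c
x<T[x,c]+2^-c x c = begin-strict
  x                                 ≡⟨ ℚ.*-identityʳ x ⟨
  x * 1ℚ                            ≡⟨ cong (x *_) (pow2-*-pow2inv c) ⟨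
  x * (pow2 c * pow2inv c)          ≡⟨ x∙yz≈yx∙z x (pow2 c) (pow2inv c) ⟩
  pow2 c * x * pow2inv c            <⟨ ℚ.*-monoˡ-<-pos (pow2inv c) (p<⌊p⌋+1 (pow2 c * x)) ⟩
  ℤ.suc f /1 * pow2inv c            ≡⟨ suc-/1-* f (pow2inv c) ⟩
  f /1 * pow2inv c + pow2inv c      ≡⟨ cong (_+ pow2inv c) (proj₂ (T-∈ℤ x c)) ⟨
  T x c + pow2inv c                 ∎
  where
  open ℚ.≤-Reasoning
  instance _ = pow2inv-pos c
  f = floor (pow2 c * x)

x+2^-d≤T[x,c]+2^-c : ∀ {x c d} → c ℕ.≤ d → x ∈ pow2inv d ℤ → x + pow2inv d ≤ T x c + pow2inv c
x+2^-d≤T[x,c]+2^-c {x} {c} {d} c≤d x∈2^-dℤ = ∈ℤ-discrete (pow2inv d) {{pow2inv-pos d}} x∈2^-dℤ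
  (∈ℤ-trans (∈ℤ-+ (T-∈ℤ x c) (∈ℤ-refl (pow2inv c))) (pow2inv-∈ℤ c≤d))
  (x<T[x,c]+2^-c x c)

∸-suc : ∀ m n → m ∸ n ∸ 1 ≡ m ∸ suc n
∸-suc m n = trans (ℕ.∸-+-assoc m n 1) (cong (m ∸_) (ℕ.+-comm n 1))

term-∈ℤ : ∀ b c j → term b c j ∈ pow2inv (c j) ℤ
term-∈ℤ b c j = + (b (suc j) ∸ b j) , refl

S-∈ℤ : ∀ b c k i → S b c k i ∈ pow2inv (c (k ∸ suc i)) ℤ
S-∈ℤ b c k zero    = T-∈ℤ (term b c k) (c (k ∸ 1))
S-∈ℤ b c k (suc i) = subst (λ n → S b c k (suc i) ∈ pow2inv (c n) ℤ) (∸-suc k (suc i))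
  (T-∈ℤ (term b c (k ∸ suc i) + S b c k i) (c (k ∸ suc i ∸ 1)))

module _ (b c : ℕ → ℕ) (k : ℕ) (c-mono : ∀ j → suc j ℕ.≤ k → c j ℕ.≤ c (suc j)) where

  c-pred≤c : ∀ j → j ℕ.≤ k → c (j ∸ 1) ℕ.≤ c j
  c-pred≤c zero    _ = ℕ.≤-refl
  c-pred≤c (suc j)   = c-mono j

  partialSum+2^-cₖ≤S+2^-cₖ₋ᵢ₋₁ : ∀ i → i ℕ.< k →
    partialSum b c k i + pow2inv (c k) ≤ S b c k i + pow2inv (c (k ∸ suc i))
  partialSum+2^-cₖ≤S+2^-cₖ₋ᵢ₋₁ zero    _     =
    x+2^-d≤T[x,c]+2^-c (c-pred≤c k ℕ.≤-refl) (term-∈ℤ b c k)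
  partialSum+2^-cₖ≤S+2^-cₖ₋ᵢ₋₁ (suc i) 1+i<k = begin
    Σᵢ + tⱼ + pow2inv (c k)             ≡⟨ xy∙z≈xz∙y Σᵢ tⱼ (pow2inv (c k)) ⟩
    Σᵢ + pow2inv (c k) + tⱼ             ≤⟨ ℚ.+-monoˡ-≤ tⱼ (partialSum+2^-cₖ≤S+2^-cₖ₋ᵢ₋₁ i (ℕ.<⇒≤ 1+i<k)) ⟩
    Sᵢ + pow2inv (c j) + tⱼ             ≡⟨ xy∙z≈zx∙y Sᵢ (pow2inv (c j)) tⱼ ⟩
    tⱼ + Sᵢ + pow2inv (c j)             ≤⟨ x+2^-d≤T[x,c]+2^-c (c-pred≤c j (ℕ.m∸n≤m k (suc i)))
                                                               (∈ℤ-+ (term-∈ℤ b c j) (S-∈ℤ b c k i)) ⟩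
    S b c k (suc i) + pow2inv (c (j ∸ 1)) ≡⟨ cong (λ n → S b c k (suc i) + pow2inv (c n)) (∸-suc k (suc i)) ⟩
    S b c k (suc i) + pow2inv (c (k ∸ suc (suc i))) ∎
    where
    open ℚ.≤-Reasoning
    j = k ∸ suc i
    Σᵢ = partialSum b c k i
    Sᵢ = S b c k i
    tⱼ = term b c j

  partialSum≤S+1 : ∀ t → t ℕ.< k → partialSum b c k t ≤ S b c k t + 1ℚ
  partialSum≤S+1 t t<k = begin
    Σₜ                                  ≡⟨ ℚ.+-identityʳ Σₜ ⟨
    Σₜ + 0ℚ                             ≤⟨ ℚ.+-monoʳ-≤ Σₜ (ℚ.<⇒≤ (ℚ.positive⁻¹ (pow2inv (c k)) {{pow2inv-pos (c k)}})) ⟩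
    Σₜ + pow2inv (c k)                  ≤⟨ partialSum+2^-cₖ≤S+2^-cₖ₋ᵢ₋₁ t t<k ⟩
    Sₜ + pow2inv (c (k ∸ suc t))        ≤⟨ ℚ.+-monoʳ-≤ Sₜ (pow2inv≤1 (c (k ∸ suc t))) ⟩
    Sₜ + 1ℚ                             ∎
    where
    open ℚ.≤-Reasoning
    Σₜ = partialSum b c k t
    Sₜ = S b c k t

signature-c-increasing : ∀ {g k b c} → IsSignatureUpTo g k b c →
                         ∀ j → suc j ℕ.≤ k → c j ℕ.< c (suc j)
signature-c-increasing {b = b} {c} (_ , b<b , g≡c , c<g) j 1+j≤k =
  subst (c j ℕ.<_) (g≡c (suc j) (b (suc j)) 1+j≤k ℕ.≤-refl (b<b (suc j) 1+j≤k)) (c<g j (ℕ.<⇒≤ 1+j≤k))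

lemma3p9 : (g : ℕ → ℕ) → NonDecreasing g →
    (k : ℕ) (b c : ℕ → ℕ) → IsSignatureUpTo g k b c →
    (t : ℕ) → t ℕ.< k →
    partialSum b c k t - 1ℚ ≤ S b c k t
lemma3p9 g _ k b c sig t t<k = p≤q+r⇒p-r≤q (partialSum≤S+1 b c k c-mono t t<k)
  where
  c-mono : ∀ j → suc j ℕ.≤ k → c j ℕ.≤ c (suc j)
  c-mono j 1+j≤k = ℕ.<⇒≤ (signature-c-increasing sig j 1+j≤k)
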